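{- For every $m\ge 2$ and $k\in\mathbb{N}$, $$\sum_{j=0}^{k}C_{j+m-1}(k-j,k+m-2)=C_m(k,k+m-1).$$
   Context: For $m\in\mathbb{N}^*$, $n\in\mathbb{N}$ and $0\le k\le n+m-1$, the Catalan's trapezoid of order $m$ is $C_m(n,k)=\binom{n+k}{k}$ if $0\le k\le m-1$ and $C_m(n,k)=\binom{n+k}{k}-\binom{n+k}{k-m}$ if $m\le k\le n+m-1$; $C_m(n,k):=0$ if $k>n+m-1$. -}

module Defs where

open import Data.Nat using (ℕ; zero; suc; _+_; _∸_; _≤ᵇ_)
open import Data.Nat.Combinatorics using (_C_)
open import Data.Bool using (if_then_else_)
open import Data.Integer using (ℤ; +_; _-_)

-- Catalan's trapezoid of order m (intended for m ≥ 1), valued in ℤ: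
--   Ctrap m n k = binom(n+k,k)                      if k ≤ m-1
--               = binom(n+k,k) - binom(n+k,k-m)     if m ≤ k ≤ n+m-1
--               = 0                                 if k > n+m-1
Ctrap : ℕ → ℕ → ℕ → ℤ
Ctrap m n k =
  if suc k ≤ᵇ m
  then + ((n + k) C k)
  else (if suc k ≤ᵇ n + m
        then + ((n + k) C k) - + ((n + k) C (k ∸ m))
        else + 0)

sumTo : ℕ → (ℕ → ℤ) → ℤ
sumTo zero f = f 0
sumTo (suc k) f = sumTo k f Data.Integer.+ f (suc k)

-- Every summand is the last nonzero entry of a row of a trapezoid: with K = n + M - 1 one has
-- C_M(n, K) = binom(n+K, K) - binom(n+K, K+1), which depends on M only through K. In the sum
-- K = k + m - 2 is the same for every j, so after reindexing by n = k - j the identity is two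
-- hockey-stick sums, whose difference is again such a last entry, now with K = k + m - 1.
module Submission where

open import Defs
open import Data.Nat using (ℕ; _+_; _∸_; _≤_)
open import Relation.Binary.PropositionalEquality using (_≡_)

open import Data.Nat using (zero; suc; s≤s; z≤n; _<_; _≤?_)
open import Data.Nat.Properties
open import Data.Nat.Combinatorics using (_C_; nCk≡nC[n∸k]; nCk+nC[k+1]≡[n+1]C[k+1])
open import Data.Nat.Combinatorics.Specification using (k>n⇒nCk≡0)
open import Data.Integer as ℤ using (ℤ; +_; _-_)
import Data.Integer.Properties as ℤ
open import Data.Integer.Solver using (module +-*-Solver)
open import Function using (_∘_)
open import Relation.Nullary.Decidable using (dec-true; dec-false)
open import Relation.Binary.PropositionalEquality
open ≡-Reasoning

sumTo-cong : ∀ k {f g : ℕ → ℤ} → (∀ {j} → j ≤ k → f j ≡ g j) → sumTo k f ≡ sumTo k g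
sumTo-cong zero    f≗g = f≗g z≤n
sumTo-cong (suc k) f≗g = cong₂ ℤ._+_ (sumTo-cong k (f≗g ∘ m≤n⇒m≤1+n)) (f≗g ≤-refl)

sumTo-suc : ∀ k (f : ℕ → ℤ) → sumTo (suc k) f ≡ f 0 ℤ.+ sumTo k (f ∘ suc)
sumTo-suc zero    f = refl
sumTo-suc (suc k) f = begin
  sumTo (suc k) f ℤ.+ f (suc (suc k))              ≡⟨ cong (ℤ._+ f (suc (suc k))) (sumTo-suc k f) ⟩
  f 0 ℤ.+ sumTo k (f ∘ suc) ℤ.+ f (suc (suc k))    ≡⟨ ℤ.+-assoc (f 0) _ _ ⟩
  f 0 ℤ.+ sumTo (suc k) (f ∘ suc)                  ∎

sumTo-reverse : ∀ k (f : ℕ → ℤ) → sumTo k (λ j → f (k ∸ j)) ≡ sumTo k f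
sumTo-reverse zero    f = refl
sumTo-reverse (suc k) f = begin
  sumTo k (λ j → f (suc k ∸ j)) ℤ.+ f (k ∸ k)   ≡⟨ cong₂ ℤ._+_ inner (cong f (n∸n≡0 k)) ⟩
  sumTo k (f ∘ suc) ℤ.+ f 0                     ≡⟨ ℤ.+-comm _ (f 0) ⟩
  f 0 ℤ.+ sumTo k (f ∘ suc)                     ≡⟨ sumTo-suc k f ⟨
  sumTo (suc k) f                               ∎
  where
  inner : sumTo k (λ j → f (suc k ∸ j)) ≡ sumTo k (f ∘ suc)
  inner = trans (sumTo-cong k (cong f ∘ +-∸-assoc 1)) (sumTo-reverse k (f ∘ suc))

sumTo-minus : ∀ k (f g : ℕ → ℤ) → sumTo k (λ i → f i - g i) ≡ sumTo k f - sumTo k g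
sumTo-minus zero    f g = refl
sumTo-minus (suc k) f g = begin
  sumTo k (λ i → f i - g i) ℤ.+ (f (suc k) - g (suc k))
    ≡⟨ cong (ℤ._+ (f (suc k) - g (suc k))) (sumTo-minus k f g) ⟩
  (sumTo k f - sumTo k g) ℤ.+ (f (suc k) - g (suc k))
    ≡⟨ interchange (sumTo k f) (sumTo k g) (f (suc k)) (g (suc k)) ⟩
  sumTo (suc k) f - sumTo (suc k) g
    ∎
  where
  open +-*-Solver
  interchange : ∀ x y z w → (x - y) ℤ.+ (z - w) ≡ (x ℤ.+ z) - (y ℤ.+ w)
  interchange = solve 4 (λ x y z w → (x :- y) :+ (z :- w) := (x :+ z) :- (y :+ w)) refl

hockeyStick : ∀ {n r} → n ≤ r → ∀ k → sumTo k (λ i → + ((i + n) C r)) ≡ + ((suc k + n) C suc r)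
hockeyStick {n} {r} n≤r zero = cong +_ (begin
  n C r                  ≡⟨ +-identityʳ (n C r) ⟨
  n C r + 0              ≡⟨ cong (_+_ (n C r)) (k>n⇒nCk≡0 (s≤s n≤r)) ⟨
  n C r + n C suc r      ≡⟨ nCk+nC[k+1]≡[n+1]C[k+1] n r ⟩
  suc n C suc r          ∎)
hockeyStick {n} {r} n≤r (suc k) = begin
  sumTo k (λ i → + ((i + n) C r)) ℤ.+ + (N C r)   ≡⟨ cong (ℤ._+ + (N C r)) (hockeyStick n≤r k) ⟩
  + (N C suc r) ℤ.+ + (N C r)                     ≡⟨ ℤ.pos-+ (N C suc r) (N C r) ⟨
  + (N C suc r + N C r)                           ≡⟨ cong +_ (+-comm (N C suc r) (N C r)) ⟩
  + (N C r + N C suc r)                           ≡⟨ cong +_ (nCk+nC[k+1]≡[n+1]C[k+1] N r) ⟩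
  + (suc N C suc r)                               ∎
  where N = suc k + n

ballot : ℕ → ℕ → ℤ
ballot K n = + ((n + K) C K) - + ((n + K) C suc K)

sumTo-ballot : ∀ K k → sumTo k (ballot K) ≡ ballot (suc K) k
sumTo-ballot K k = begin
  sumTo k (ballot K)                                              ≡⟨ sumTo-minus k _ _ ⟩
  sumTo k (λ i → + ((i + K) C K)) - sumTo k (λ i → + ((i + K) C suc K))
                                                                  ≡⟨ cong₂ _-_ (hockeyStick {K} ≤-refl k) (hockeyStick {K} (n≤1+n K) k) ⟩
  + ((suc k + K) C suc K) - + ((suc k + K) C suc (suc K))         ≡⟨ cong (λ N → + (N C suc K) - + (N C suc (suc K))) (+-suc k K) ⟨
  ballot (suc K) k                                                ∎

Ctrap-below : ∀ {M K} n → K < M → Ctrap M n K ≡ + ((n + K) C K)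
Ctrap-below {M} {K} n K<M rewrite dec-true (suc K ≤? M) K<M = refl

Ctrap-within : ∀ {M K} n → M ≤ K → K < n + M →
               Ctrap M n K ≡ + ((n + K) C K) - + ((n + K) C (K ∸ M))
Ctrap-within {M} {K} n M≤K K<n+M
  rewrite dec-false (suc K ≤? M) (≤⇒≯ M≤K) | dec-true (suc K ≤? n + M) K<n+M = refl

Ctrap-last : ∀ r n → Ctrap (suc r) n (n + r) ≡ ballot (n + r) n
Ctrap-last r zero = begin
  Ctrap (suc r) 0 r               ≡⟨ Ctrap-below {suc r} 0 ≤-refl ⟩
  + (r C r)                       ≡⟨ ℤ.+-identityʳ _ ⟨
  + (r C r) - + 0                 ≡⟨ cong (λ i → + (r C r) - + i) (k>n⇒nCk≡0 (n<1+n r)) ⟨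
  ballot r 0                      ∎
Ctrap-last r (suc t) = begin
  Ctrap (suc r) (suc t) K         ≡⟨ Ctrap-within (suc t) (s≤s (m≤n+m r t)) (≤-reflexive (sym (+-suc (suc t) r))) ⟩
  + (N C K) - + (N C (K ∸ suc r)) ≡⟨ cong (λ i → + (N C K) - + i) reflected ⟩
  ballot K (suc t)                ∎
  where
  K = suc t + r
  N = suc t + K
  reflected : N C (K ∸ suc r) ≡ N C suc K
  reflected = begin
    N C (K ∸ suc r)     ≡⟨ cong (N C_) (m+n∸n≡m t r) ⟩
    N C t               ≡⟨ nCk≡nC[n∸k] (m≤n⇒m≤1+n (m≤m+n t K)) ⟩
    N C (N ∸ t)         ≡⟨ cong (λ i → N C (i ∸ t)) (+-suc t K) ⟨
    N C (t + suc K ∸ t) ≡⟨ cong (N C_) (m+n∸m≡n t (suc K)) ⟩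
    N C suc K           ∎

summand≡ballot : ∀ p {k j} → j ≤ k →
  Ctrap (j + suc (suc p) ∸ 1) (k ∸ j) (k + suc (suc p) ∸ 2) ≡ ballot (k + p) (k ∸ j)
summand≡ballot p {k} {j} j≤k = begin
  Ctrap (j + suc (suc p) ∸ 1) (k ∸ j) (k + suc (suc p) ∸ 2) ≡⟨ cong₂ (λ M K → Ctrap M (k ∸ j) K) order height ⟩
  Ctrap (suc (j + p)) (k ∸ j) (k ∸ j + (j + p))             ≡⟨ Ctrap-last (j + p) (k ∸ j) ⟩
  ballot (k ∸ j + (j + p)) (k ∸ j)                           ≡⟨ cong (λ K → ballot K (k ∸ j)) split ⟨
  ballot (k + p) (k ∸ j)                                     ∎
  where
  split : k + p ≡ k ∸ j + (j + p)
  split = trans (cong (_+ p) (sym (m∸n+n≡m j≤k))) (+-assoc (k ∸ j) j p)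
  order : j + suc (suc p) ∸ 1 ≡ suc (j + p)
  order = trans (+-∸-assoc j (s≤s z≤n)) (+-suc j p)
  height : k + suc (suc p) ∸ 2 ≡ k ∸ j + (j + p)
  height = trans (+-∸-assoc k (s≤s (s≤s z≤n))) split

mainTheorem12 : (m k : ℕ) → 2 ≤ m →
    sumTo k (λ j → Ctrap (j + m ∸ 1) (k ∸ j) (k + m ∸ 2)) ≡ Ctrap m k (k + m ∸ 1)
mainTheorem12 (suc (suc p)) k (s≤s (s≤s z≤n)) = begin
  sumTo k (λ j → Ctrap (j + m ∸ 1) (k ∸ j) (k + m ∸ 2)) ≡⟨ sumTo-cong k (summand≡ballot p) ⟩
  sumTo k (λ j → ballot (k + p) (k ∸ j))                ≡⟨ sumTo-reverse k (ballot (k + p)) ⟩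
  sumTo k (ballot (k + p))                              ≡⟨ sumTo-ballot (k + p) k ⟩
  ballot (suc (k + p)) k                                ≡⟨ cong (λ K → ballot K k) (+-suc k p) ⟨
  ballot (k + suc p) k                                  ≡⟨ Ctrap-last (suc p) k ⟨
  Ctrap m k (k + suc p)                                 ≡⟨ cong (Ctrap m k) (+-∸-assoc k (s≤s z≤n)) ⟨
  Ctrap m k (k + m ∸ 1)                                 ∎
  where m = suc (suc p)
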